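{- Let $n\geq 1$ be a natural number, $[n]=\{1,\ldots,n\}$, and let $(L,\vee,\wedge,^*,0,1)$ be a De Morgan algebra (a bounded distributive lattice with a decreasing involution $^*$ satisfying the De Morgan laws). (a) Suppose $\varphi_1,\ldots,\varphi_n$ are unary operations on $L$ such that, for all $i,j\in[n]$ and $x,y\in L$: (L1) $\varphi_i(x\vee y)=\varphi_i(x)\vee\varphi_i(y)$; (L2) $\varphi_i(x)\vee\varphi_i(x)^*=1$; (L3) $\varphi_i\circ\varphi_j=\varphi_j$; (L4) $\varphi_i(x^*)=\varphi_{n+1-i}(x)^*$; (L5) if $i\leq j$ then $\varphi_i(x)\leq\varphi_j(x)$; (L6) if $\varphi_i(x)=\varphi_i(y)$ for all $i\in[n]$ then $x=y$. Define $\mathrm{J}_n(x):=\varphi_1(x)$ and $\mathrm{J}_i(x):=\varphi_{n-i+1}(x)\wedge\varphi_{n-i}(x)^*$ for $i\in[n-1]$. Then $\mathrm{J}_1,\ldots,\mathrm{J}_n$ satisfy, for all $i\in[n]$, $k\in[n-1]$, $1<l\leq n$ and $x,y\in L$: (J1) $\bigvee_{k=n-i+1}^n\mathrm{J}_k(x\vee y)=\bigvee_{k=n-i+1}^n(\mathrm{J}_k(x)\vee\mathrm{J}_k(y))$; (J2) $\mathrm{J}_i(x)\vee\mathrm{J}_i(x)^*=1$; (J3) $\mathrm{J}_k(\mathrm{J}_i(x))=0$ and $\mathrm{J}_n(\mathrm{J}_i(x))=\mathrm{J}_i(x)$; (J4) $\mathrm{J}_k(x^*)=\mathrm{J}_{n-k}(x)$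 and $\mathrm{J}_n(x^*)=\bigwedge_{i=1}^n\mathrm{J}_i(x)^*$; (J5) $\mathrm{J}_l(x)\leq(\mathrm{J}_1(x)\vee\ldots\vee\mathrm{J}_{l-1}(x))^*$; (J6) if $\mathrm{J}_i(x)=\mathrm{J}_i(y)$ for all $i\in[n]$ then $x=y$. (b) Conversely, if $\mathrm{J}_1,\ldots,\mathrm{J}_n$ are unary operations on $L$ satisfying (J1)–(J6), and one defines $\varphi_i(x):=\bigvee_{k=n-i+1}^n\mathrm{J}_k(x)$ for $i\in[n]$, then $\varphi_1,\ldots,\varphi_n$ satisfy (L1)–(L6). Hence the two definitions of a Łukasiewicz–Moisil algebra of order $n+1$ (via the $\varphi$'s and via the $\mathrm{J}$'s) are equivalent.
   Context: A Łukasiewicz–Moisil algebra of order $n+1$ was originally defined as a De Morgan algebra with Chrysippian endomorphisms $\varphi_1,\ldots,\varphi_n$ satisfying (L1)–(L6); the paper proposes the alternative definition via operations $\mathrm{J}_1,\ldots,\mathrm{J}_n$ satisfying (J1)–(J6). -}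

module Defs where

open import Level using (0ℓ)
open import Data.Nat using (ℕ; zero; suc; _∸_; _≤_; _<_; _≡ᵇ_)
open import Data.Bool using (if_then_else_)
open import Data.Product using (_×_)
open import Relation.Binary.PropositionalEquality using (_≡_)
open import Algebra.Core using (Op₁; Op₂)
open import Algebra.Lattice.Structures using (IsDistributiveLattice)

record DeMorganAlgebra : Set₁ where
  infixr 6 _∨_
  infixr 7 _∧_
  infix 8 _*
  infix 4 _≼_
  field
    Carrier : Set
    _∨_ : Op₂ Carrier
    _∧_ : Op₂ Carrier
    _* : Op₁ Carrier
    𝟘 : Carrier
    𝟙 : Carrier
    isDistributiveLattice : IsDistributiveLattice _≡_ _∨_ _∧_
    ∨-identityʳ : ∀ x → x ∨ 𝟘 ≡ x
    ∧-identityʳ : ∀ x → x ∧ 𝟙 ≡ x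
    *-involutive : ∀ x → (x *) * ≡ x
    deMorgan-∨ : ∀ x y → (x ∨ y) * ≡ (x *) ∧ (y *)
    deMorgan-∧ : ∀ x y → (x ∧ y) * ≡ (x *) ∨ (y *)

  _≼_ : Carrier → Carrier → Set
  x ≼ y = x ∧ y ≡ x

  -- ⋁ f a m  =  f a ∨ f (a+1) ∨ … ∨ f (a+m-1)   (empty join = 0)
  ⋁ : (ℕ → Carrier) → ℕ → ℕ → Carrier
  ⋁ f a zero = 𝟘
  ⋁ f a (suc m) = f a ∨ ⋁ f (suc a) m

  ⋀ : (ℕ → Carrier) → ℕ → ℕ → Carrier
  ⋀ f a zero = 𝟙
  ⋀ f a (suc m) = f a ∧ ⋀ f (suc a) m

module _ (L : DeMorganAlgebra) where
  open DeMorganAlgebra L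

  -- Families of unary operations indexed by ℕ; only indices in [n] = {1..n} matter.
  -- Axioms (L1)–(L6) for φ₁,…,φₙ.
  record LAxioms (n : ℕ) (φ : ℕ → Carrier → Carrier) : Set where
    field
      L1 : ∀ i → 1 ≤ i → i ≤ n → ∀ x y → φ i (x ∨ y) ≡ φ i x ∨ φ i y
      L2 : ∀ i → 1 ≤ i → i ≤ n → ∀ x → φ i x ∨ (φ i x) * ≡ 𝟙
      L3 : ∀ i j → 1 ≤ i → i ≤ n → 1 ≤ j → j ≤ n → ∀ x → φ i (φ j x) ≡ φ j x
      L4 : ∀ i → 1 ≤ i → i ≤ n → ∀ x → φ i (x *) ≡ (φ (suc n ∸ i) x) *
      L5 : ∀ i j → 1 ≤ i → i ≤ n → 1 ≤ j → j ≤ n → i ≤ j → ∀ x → φ i x ≼ φ j x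
      L6 : ∀ x y → (∀ i → 1 ≤ i → i ≤ n → φ i x ≡ φ i y) → x ≡ y

  record JAxioms (n : ℕ) (J : ℕ → Carrier → Carrier) : Set where
    field
      -- ⋁_{k=n-i+1}^{n} has first index n-i+1 and i terms
      J1 : ∀ i → 1 ≤ i → i ≤ n → ∀ x y →
           ⋁ (λ k → J k (x ∨ y)) (suc (n ∸ i)) i ≡ ⋁ (λ k → J k x ∨ J k y) (suc (n ∸ i)) i
      J2 : ∀ i → 1 ≤ i → i ≤ n → ∀ x → J i x ∨ (J i x) * ≡ 𝟙
      J3a : ∀ i k → 1 ≤ i → i ≤ n → 1 ≤ k → k < n → ∀ x → J k (J i x) ≡ 𝟘
      J3b : ∀ i → 1 ≤ i → i ≤ n → ∀ x → J n (J i x) ≡ J i x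
      J4a : ∀ k → 1 ≤ k → k < n → ∀ x → J k (x *) ≡ J (n ∸ k) x
      J4b : ∀ x → J n (x *) ≡ ⋀ (λ i → (J i x) *) 1 n
      J5 : ∀ l → 1 < l → l ≤ n → ∀ x → J l x ≼ (⋁ (λ k → J k x) 1 (l ∸ 1)) *
      J6 : ∀ x y → (∀ i → 1 ≤ i → i ≤ n → J i x ≡ J i y) → x ≡ y

  JfromΦ : ℕ → (ℕ → Carrier → Carrier) → ℕ → Carrier → Carrier
  JfromΦ n φ i x = if i ≡ᵇ n then φ 1 x else (φ (suc (n ∸ i)) x ∧ (φ (n ∸ i) x) *)

  ΦfromJ : ℕ → (ℕ → Carrier → Carrier) → ℕ → Carrier → Carrier
  ΦfromJ n J i x = ⋁ (λ k → J k x) (suc (n ∸ i)) i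

module Submission where

-- Both directions rest on one picture.  The values φ₁ x ≤ … ≤ φₙ x form a
-- chain of complemented elements, and Jₙ x, J_{n-1} x, …, J₁ x are its
-- successive differences: φ₁ x = Jₙ x and φ_{m+1} x = J_{n-m} x ∨ φₘ x with
-- J_{n-m} x = φ_{m+1} x ∧ (φₘ x)*.  Hence φᵢ x is the join of the top
-- segment J_{n-i+1} x ∨ … ∨ Jₙ x, and conversely the J's are recovered
-- from consecutive φ's because the J's are pairwise orthogonal.

open import Level using (0ℓ)
open import Data.Nat using (ℕ; zero; suc; _+_; _∸_; _≤_; _<_; _≡ᵇ_; z≤n; s≤s; s≤s⁻¹)
open import Data.Nat.Properties
  using ( ≤-refl; ≤-trans; <⇒≤; <-≤-trans; <-irrefl; n≤1+n; m<m+n; +-suc; +-identityʳ; ≤⇒≯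
        ; m≤n⇒m<n∨m≡n; m∸n≤m; m<n⇒0<n∸m; m∸[m∸n]≡n; m∸n+n≡m; n∸n≡0
        ; +-∸-assoc; ∸-monoʳ-≤; ∸-monoʳ-<; ≡ᵇ⇒≡; ≡⇒≡ᵇ )
open import Data.Bool using (true; false)
open import Data.Empty using (⊥-elim)
open import Data.Product using (_×_; _,_; uncurry)
open import Data.Sum using (inj₁; inj₂)
open import Relation.Binary.PropositionalEquality
  using (_≡_; refl; sym; trans; cong; cong₂; subst; subst₂; module ≡-Reasoning)
open import Algebra.Lattice.Bundles using (DistributiveLattice)
open import Algebra.Lattice.Structures using (IsDistributiveLattice)
import Algebra.Lattice.Properties.Lattice as LatticeProperties
open import Defs

suc-∸-suc : ∀ {n i} → i < n → suc (n ∸ suc i) ≡ n ∸ i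
suc-∸-suc i<n = sym (+-∸-assoc 1 i<n)

∸-< : ∀ {n i} → 1 ≤ i → i ≤ n → n ∸ i < n
∸-< 1≤i i≤n = ∸-monoʳ-< 1≤i i≤n

suc-∸-∸ : ∀ {n i} → i ≤ n → suc n ∸ (n ∸ i) ≡ suc i
suc-∸-∸ {n} {i} i≤n = trans (+-∸-assoc 1 (m∸n≤m n i)) (cong suc (m∸[m∸n]≡n i≤n))

reflect-bounds : ∀ {n i} → 1 ≤ i → i ≤ n → 1 ≤ suc n ∸ i × suc n ∸ i ≤ n
reflect-bounds {n} {suc i} _ i<n = m<n⇒0<n∸m i<n , m∸n≤m n i

top-end⇒ : ∀ {n i k} → i ≤ n → k < suc (n ∸ i) + i → k ≤ n
top-end⇒ {k = k} i≤n k< = subst (k ≤_) (m∸n+n≡m i≤n) (s≤s⁻¹ k<)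

top-end⇐ : ∀ {n i k} → i ≤ n → k ≤ n → k < suc (n ∸ i) + i
top-end⇐ {k = k} i≤n k≤n = s≤s (subst (k ≤_) (sym (m∸n+n≡m i≤n)) k≤n)

module DeMorganProperties (L : DeMorganAlgebra) where
  open DeMorganAlgebra L
  open IsDistributiveLattice isDistributiveLattice
    using ( ∨-comm; ∨-assoc; ∧-comm; ∧-assoc; ∨-absorbs-∧; ∧-absorbs-∨
          ; ∨-distribˡ-∧; ∧-distribʳ-∨ )
  open ≡-Reasoning

  distributiveLattice : DistributiveLattice 0ℓ 0ℓ
  distributiveLattice = record
    { Carrier = Carrier ; _≈_ = _≡_ ; _∨_ = _∨_ ; _∧_ = _∧_
    ; isDistributiveLattice = isDistributiveLattice }

  open LatticeProperties (DistributiveLattice.lattice distributiveLattice) using (∧-idem)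

  ∨-identityˡ : ∀ x → 𝟘 ∨ x ≡ x
  ∨-identityˡ x = trans (∨-comm 𝟘 x) (∨-identityʳ x)

  ∧-identityˡ : ∀ x → 𝟙 ∧ x ≡ x
  ∧-identityˡ x = trans (∧-comm 𝟙 x) (∧-identityʳ x)

  𝟘* : 𝟘 * ≡ 𝟙
  𝟘* = begin
    𝟘 *                ≡⟨ sym (∧-identityʳ _) ⟩
    𝟘 * ∧ 𝟙            ≡⟨ cong (𝟘 * ∧_) (sym (*-involutive 𝟙)) ⟩
    𝟘 * ∧ (𝟙 *) *      ≡⟨ sym (deMorgan-∨ 𝟘 (𝟙 *)) ⟩
    (𝟘 ∨ 𝟙 *) *        ≡⟨ cong _* (∨-identityˡ _) ⟩
    (𝟙 *) *            ≡⟨ *-involutive 𝟙 ⟩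
    𝟙                  ∎

  𝟙* : 𝟙 * ≡ 𝟘
  𝟙* = trans (cong _* (sym 𝟘*)) (*-involutive 𝟘)

  ∧-via-∨ : ∀ x y → (x * ∨ y *) * ≡ x ∧ y
  ∧-via-∨ x y = trans (deMorgan-∨ (x *) (y *)) (cong₂ _∧_ (*-involutive x) (*-involutive y))

  ≼-refl : ∀ {x} → x ≼ x
  ≼-refl {x} = ∧-idem x

  ≼-trans : ∀ {x y z} → x ≼ y → y ≼ z → x ≼ z
  ≼-trans {x} {y} {z} x≼y y≼z = begin
    x ∧ z          ≡⟨ cong (_∧ z) (sym x≼y) ⟩
    (x ∧ y) ∧ z    ≡⟨ ∧-assoc x y z ⟩
    x ∧ (y ∧ z)    ≡⟨ cong (x ∧_) y≼z ⟩
    x ∧ y          ≡⟨ x≼y ⟩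
    x              ∎

  ≼⇒∨≡ : ∀ {x y} → x ≼ y → x ∨ y ≡ y
  ≼⇒∨≡ {x} {y} x≼y = begin
    x ∨ y          ≡⟨ cong (_∨ y) (sym x≼y) ⟩
    (x ∧ y) ∨ y    ≡⟨ ∨-comm _ y ⟩
    y ∨ (x ∧ y)    ≡⟨ cong (y ∨_) (∧-comm x y) ⟩
    y ∨ (y ∧ x)    ≡⟨ ∨-absorbs-∧ y x ⟩
    y              ∎

  x≼x∨y : ∀ {x y} → x ≼ x ∨ y
  x≼x∨y {x} {y} = ∧-absorbs-∨ x y

  y≼x∨y : ∀ {x y} → y ≼ x ∨ y
  y≼x∨y {x} {y} = trans (cong (y ∧_) (∨-comm x y)) (∧-absorbs-∨ y x)

  x∧y≼x : ∀ {x y} → x ∧ y ≼ x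
  x∧y≼x {x} {y} = begin
    (x ∧ y) ∧ x    ≡⟨ ∧-comm _ x ⟩
    x ∧ (x ∧ y)    ≡⟨ sym (∧-assoc x x y) ⟩
    (x ∧ x) ∧ y    ≡⟨ cong (_∧ y) (∧-idem x) ⟩
    x ∧ y          ∎

  x∧y≼y : ∀ {x y} → x ∧ y ≼ y
  x∧y≼y {x} {y} = subst (_≼ y) (∧-comm y x) x∧y≼x

  𝟘≼ : ∀ {x} → 𝟘 ≼ x
  𝟘≼ {x} = trans (cong (𝟘 ∧_) (sym (∨-identityˡ x))) (∧-absorbs-∨ 𝟘 x)

  𝟙≼⇒≡𝟙 : ∀ {x} → 𝟙 ≼ x → x ≡ 𝟙
  𝟙≼⇒≡𝟙 {x} 𝟙≼x = trans (sym (∧-identityˡ x)) 𝟙≼x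

  ∨-lub : ∀ {x y z} → x ≼ z → y ≼ z → x ∨ y ≼ z
  ∨-lub {x} {y} {z} x≼z y≼z = trans (∧-distribʳ-∨ z x y) (cong₂ _∨_ x≼z y≼z)

  *-antitone : ∀ {x y} → x ≼ y → y * ≼ x *
  *-antitone {x} {y} x≼y = begin
    y * ∧ x *      ≡⟨ ∧-comm _ _ ⟩
    x * ∧ y *      ≡⟨ sym (deMorgan-∨ x y) ⟩
    (x ∨ y) *      ≡⟨ cong _* (≼⇒∨≡ x≼y) ⟩
    y *            ∎

  _⟂_ : Carrier → Carrier → Set
  x ⟂ y = x ≼ y *

  ⟂-sym : ∀ {x y} → x ⟂ y → y ⟂ x
  ⟂-sym {x} {y} x⟂y = subst (_≼ x *) (*-involutive y) (*-antitone x⟂y)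

  -- Complemented elements (x ∨ x* = 1) form a Boolean subalgebra; the
  -- values of φᵢ and of Jᵢ live there.

  Complemented : Carrier → Set
  Complemented x = x ∨ x * ≡ 𝟙

  complemented-∧* : ∀ {x} → Complemented x → x ∧ x * ≡ 𝟘
  complemented-∧* {x} c = begin
    x ∧ x *                ≡⟨ sym (*-involutive _) ⟩
    ((x ∧ x *) *) *        ≡⟨ cong _* (deMorgan-∧ x (x *)) ⟩
    (x * ∨ (x *) *) *      ≡⟨ cong (λ u → (x * ∨ u) *) (*-involutive x) ⟩
    (x * ∨ x) *            ≡⟨ cong _* (trans (∨-comm (x *) x) c) ⟩
    𝟙 *                    ≡⟨ 𝟙* ⟩
    𝟘                      ∎

  complemented-𝟘 : Complemented 𝟘
  complemented-𝟘 = trans (∨-identityˡ _) 𝟘*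

  complemented-* : ∀ {x} → Complemented x → Complemented (x *)
  complemented-* {x} c = trans (cong (x * ∨_) (*-involutive x)) (trans (∨-comm (x *) x) c)

  above-complement : ∀ {x z} → Complemented x → x ≼ z → x * ≼ z → z ≡ 𝟙
  above-complement {x} {z} c x≼z x*≼z = 𝟙≼⇒≡𝟙 (subst (_≼ z) c (∨-lub x≼z x*≼z))

  complemented-∨ : ∀ {x y} → Complemented x → Complemented y → Complemented (x ∨ y)
  complemented-∨ {x} {y} cx cy = begin
    (x ∨ y) ∨ (x ∨ y) *                   ≡⟨ cong ((x ∨ y) ∨_) (deMorgan-∨ x y) ⟩
    (x ∨ y) ∨ (x * ∧ y *)                 ≡⟨ ∨-distribˡ-∧ (x ∨ y) (x *) (y *) ⟩
    ((x ∨ y) ∨ x *) ∧ ((x ∨ y) ∨ y *)     ≡⟨ cong₂ _∧_ topˣ topʸ ⟩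
    𝟙 ∧ 𝟙                                 ≡⟨ ∧-idem 𝟙 ⟩
    𝟙                                     ∎
    where
    topˣ : (x ∨ y) ∨ x * ≡ 𝟙
    topˣ = above-complement cx (≼-trans x≼x∨y x≼x∨y) y≼x∨y
    topʸ : (x ∨ y) ∨ y * ≡ 𝟙
    topʸ = above-complement cy (≼-trans y≼x∨y x≼x∨y) y≼x∨y

  complemented-∧ : ∀ {x y} → Complemented x → Complemented y → Complemented (x ∧ y)
  complemented-∧ {x} {y} cx cy =
    subst Complemented (∧-via-∨ x y) (complemented-* (complemented-∨ (complemented-* cx) (complemented-* cy)))

  difference-∨ : ∀ {p q} → Complemented p → p ≼ q → (q ∧ p *) ∨ p ≡ q
  difference-∨ {p} {q} c p≼q = begin
    (q ∧ p *) ∨ p          ≡⟨ ∨-comm _ p ⟩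
    p ∨ (q ∧ p *)          ≡⟨ ∨-distribˡ-∧ p q (p *) ⟩
    (p ∨ q) ∧ (p ∨ p *)    ≡⟨ cong ((p ∨ q) ∧_) c ⟩
    (p ∨ q) ∧ 𝟙            ≡⟨ ∧-identityʳ _ ⟩
    p ∨ q                  ≡⟨ ≼⇒∨≡ p≼q ⟩
    q                      ∎

  ∨-∧*-cancel : ∀ {j s} → Complemented s → j ⟂ s → (j ∨ s) ∧ s * ≡ j
  ∨-∧*-cancel {j} {s} c j⟂s = begin
    (j ∨ s) ∧ s *          ≡⟨ ∧-distribʳ-∨ (s *) j s ⟩
    (j ∧ s *) ∨ (s ∧ s *)  ≡⟨ cong₂ _∨_ j⟂s (complemented-∧* c) ⟩
    j ∨ 𝟘                  ≡⟨ ∨-identityʳ j ⟩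
    j                      ∎

  ∨-*-absorb : ∀ {j r} → Complemented j → j ⟂ r → j ∨ (j ∨ r) * ≡ r *
  ∨-*-absorb {j} {r} c j⟂r = begin
    j ∨ (j ∨ r) *          ≡⟨ cong (j ∨_) (deMorgan-∨ j r) ⟩
    j ∨ (j * ∧ r *)        ≡⟨ ∨-distribˡ-∧ j (j *) (r *) ⟩
    (j ∨ j *) ∧ (j ∨ r *)  ≡⟨ cong (_∧ (j ∨ r *)) c ⟩
    𝟙 ∧ (j ∨ r *)          ≡⟨ ∧-identityˡ _ ⟩
    j ∨ r *                ≡⟨ ≼⇒∨≡ j⟂r ⟩
    r *                    ∎

  ∨-interchange : ∀ a b c d → (a ∨ b) ∨ (c ∨ d) ≡ (a ∨ c) ∨ (b ∨ d)
  ∨-interchange a b c d = begin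
    (a ∨ b) ∨ (c ∨ d)    ≡⟨ ∨-assoc a b (c ∨ d) ⟩
    a ∨ (b ∨ (c ∨ d))    ≡⟨ cong (a ∨_) (sym (∨-assoc b c d)) ⟩
    a ∨ ((b ∨ c) ∨ d)    ≡⟨ cong (λ u → a ∨ (u ∨ d)) (∨-comm b c) ⟩
    a ∨ ((c ∨ b) ∨ d)    ≡⟨ cong (a ∨_) (∨-assoc c b d) ⟩
    a ∨ (c ∨ (b ∨ d))    ≡⟨ sym (∨-assoc a c (b ∨ d)) ⟩
    (a ∨ c) ∨ (b ∨ d)    ∎

  ⋁-∨ : ∀ f g a m → ⋁ (λ k → f k ∨ g k) a m ≡ ⋁ f a m ∨ ⋁ g a m
  ⋁-∨ f g a zero    = sym (∨-identityʳ 𝟘)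
  ⋁-∨ f g a (suc m) =
    trans (cong ((f a ∨ g a) ∨_) (⋁-∨ f g (suc a) m))
          (∨-interchange (f a) (g a) (⋁ f (suc a) m) (⋁ g (suc a) m))

  ⋁-hom : ∀ (h : Carrier → Carrier) → (∀ u v → h (u ∨ v) ≡ h u ∨ h v) →
          ∀ f a m → h (⋁ f a (suc m)) ≡ ⋁ (λ k → h (f k)) a (suc m)
  ⋁-hom h h-∨ f a zero    = trans (cong h (∨-identityʳ (f a))) (sym (∨-identityʳ (h (f a))))
  ⋁-hom h h-∨ f a (suc m) = trans (h-∨ (f a) _) (cong (h (f a) ∨_) (⋁-hom h h-∨ f (suc a) m))

  ⋀-* : ∀ f a m → ⋀ (λ i → (f i) *) a m ≡ (⋁ f a m) *
  ⋀-* f a zero    = sym 𝟘*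
  ⋀-* f a (suc m) = trans (cong ((f a) * ∧_) (⋀-* f (suc a) m)) (sym (deMorgan-∨ (f a) _))

  range-tail : ∀ {a m k} → suc a ≤ k → k < suc a + m → a ≤ k × k < a + suc m
  range-tail {a} {m} {k} a<k k< = <⇒≤ a<k , subst (k <_) (sym (+-suc a m)) k<

  ⋁-closed : (P : Carrier → Set) → P 𝟘 → (∀ {u v} → P u → P v → P (u ∨ v)) →
             ∀ f a m → (∀ k → a ≤ k → k < a + m → P (f k)) → P (⋁ f a m)
  ⋁-closed P P𝟘 P∨ f a zero    Pf = P𝟘
  ⋁-closed P P𝟘 P∨ f a (suc m) Pf =
    P∨ (Pf a ≤-refl (m<m+n a (s≤s z≤n)))
       (⋁-closed P P𝟘 P∨ f (suc a) m (λ k a<k k< → uncurry (Pf k) (range-tail a<k k<)))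

  ⋁-lub : ∀ {v} f a m → (∀ k → a ≤ k → k < a + m → f k ≼ v) → ⋁ f a m ≼ v
  ⋁-lub {v} = ⋁-closed (_≼ v) 𝟘≼ ∨-lub

  ⋁-ub : ∀ f a m {k} → a ≤ k → k < a + m → f k ≼ ⋁ f a m
  ⋁-ub f a zero    {k} a≤k k< = ⊥-elim (≤⇒≯ a≤k (subst (k <_) (+-identityʳ a) k<))
  ⋁-ub f a (suc m) {k} a≤k k< with m≤n⇒m<n∨m≡n a≤k
  ... | inj₂ refl = x≼x∨y
  ... | inj₁ a<k  = ≼-trans (⋁-ub f (suc a) m a<k (subst (k <_) (+-suc a m) k<)) y≼x∨y

  ⋁-cong : ∀ f g a m → (∀ k → a ≤ k → k < a + m → f k ≡ g k) → ⋁ f a m ≡ ⋁ g a m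
  ⋁-cong f g a zero    f≡g = refl
  ⋁-cong f g a (suc m) f≡g =
    cong₂ _∨_ (f≡g a ≤-refl (m<m+n a (s≤s z≤n)))
              (⋁-cong f g (suc a) m (λ k a<k k< → uncurry (f≡g k) (range-tail a<k k<)))

-- Joins over the top segment (n-i, n] = {n-i+1, …, n} of [1, n]; in the
-- theorem φᵢ x is always ⋁top (λ k → J k x) i.

module TopSegments (L : DeMorganAlgebra) (n : ℕ) where
  open DeMorganAlgebra L
  open DeMorganProperties L

  ⋁top : (ℕ → Carrier) → ℕ → Carrier
  ⋁top f i = ⋁ f (suc (n ∸ i)) i

  ⋁top-step : ∀ f {i} → i < n → ⋁top f (suc i) ≡ f (n ∸ i) ∨ ⋁top f i
  ⋁top-step f {i} i<n = cong (λ a → ⋁ f a (suc i)) (suc-∸-suc i<n)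

  ⋁top-full : ∀ f → ⋁top f n ≡ ⋁ f 1 n
  ⋁top-full f = cong (λ a → ⋁ f (suc a) n) (n∸n≡0 n)

  ⋁top-closed : (P : Carrier → Set) → P 𝟘 → (∀ {u v} → P u → P v → P (u ∨ v)) →
                ∀ f {i} → i ≤ n → (∀ k → n ∸ i < k → k ≤ n → P (f k)) → P (⋁top f i)
  ⋁top-closed P P𝟘 P∨ f {i} i≤n Pf =
    ⋁-closed P P𝟘 P∨ f (suc (n ∸ i)) i (λ k n-i<k k< → Pf k n-i<k (top-end⇒ i≤n k<))

  ⋁top-lub : ∀ f {i v} → i ≤ n → (∀ k → n ∸ i < k → k ≤ n → f k ≼ v) → ⋁top f i ≼ v
  ⋁top-lub f {v = v} = ⋁top-closed (_≼ v) 𝟘≼ ∨-lub f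

  ⋁top-ub : ∀ f {i k} → i ≤ n → n ∸ i < k → k ≤ n → f k ≼ ⋁top f i
  ⋁top-ub f {i} i≤n n-i<k k≤n = ⋁-ub f (suc (n ∸ i)) i n-i<k (top-end⇐ i≤n k≤n)

  ⋁top-mono : ∀ f {i j} → i ≤ j → j ≤ n → ⋁top f i ≼ ⋁top f j
  ⋁top-mono f {i} {j} i≤j j≤n =
    ⋁top-lub f (≤-trans i≤j j≤n)
      (λ k n-i<k k≤n → ⋁top-ub f j≤n (widen n-i<k) k≤n)
    where
    widen : ∀ {k} → n ∸ i < k → n ∸ j < k
    widen n-i<k = ≤-trans (s≤s (∸-monoʳ-≤ n i≤j)) n-i<k

  ⋁top-cong : ∀ f g {i} → i ≤ n → (∀ k → 1 ≤ k → k ≤ n → f k ≡ g k) → ⋁top f i ≡ ⋁top g i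
  ⋁top-cong f g {i} i≤n f≡g =
    ⋁-cong f g (suc (n ∸ i)) i (λ k n-i<k k< → f≡g k (≤-trans (s≤s z≤n) n-i<k) (top-end⇒ i≤n k<))

  ⋁top-single : ∀ f → (∀ k → 1 ≤ k → k < n → f k ≡ 𝟘) → ∀ i → 1 ≤ i → i ≤ n → ⋁top f i ≡ f n
  ⋁top-single f f≡𝟘 (suc zero)    _ 1≤n = trans (⋁top-step f 1≤n) (∨-identityʳ _)
  ⋁top-single f f≡𝟘 (suc (suc i)) _ i<n = begin
    ⋁top f (suc (suc i))               ≡⟨ ⋁top-step f i<n ⟩
    f (n ∸ suc i) ∨ ⋁top f (suc i)     ≡⟨ cong₂ _∨_ (f≡𝟘 _ (m<n⇒0<n∸m i<n) (∸-< (s≤s z≤n) (<⇒≤ i<n)))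
                                                    (⋁top-single f f≡𝟘 (suc i) (s≤s z≤n) (<⇒≤ i<n)) ⟩
    𝟘 ∨ f n                            ≡⟨ ∨-identityˡ _ ⟩
    f n                                ∎
    where open ≡-Reasoning

  ⋁top-hom : ∀ (h : Carrier → Carrier) → (∀ u v → h (u ∨ v) ≡ h u ∨ h v) →
             ∀ f {i} → 1 ≤ i → h (⋁top f i) ≡ ⋁top (λ k → h (f k)) i
  ⋁top-hom h h-∨ f {suc i} _ = ⋁-hom h h-∨ f (suc (n ∸ suc i)) i

-- Part (a): from φ₁, …, φₙ satisfying L1–L6 to J := JfromΦ satisfying J1–J6.

module FromΦ (L : DeMorganAlgebra) (n : ℕ) (1≤n : 1 ≤ n)
             (φ : ℕ → DeMorganAlgebra.Carrier L → DeMorganAlgebra.Carrier L)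
             (ax : LAxioms L n φ) where
  open DeMorganAlgebra L
  open IsDistributiveLattice isDistributiveLattice using (∧-comm)
  open DeMorganProperties L
  open TopSegments L n
  open LAxioms ax
  open ≡-Reasoning

  J : ℕ → Carrier → Carrier
  J = JfromΦ L n φ

  J-top : ∀ x → J n x ≡ φ 1 x
  J-top x with n ≡ᵇ n | ≡⇒≡ᵇ n n refl
  ... | true  | _  = refl
  ... | false | ()

  J-below : ∀ {i} x → i < n → J i x ≡ φ (suc (n ∸ i)) x ∧ (φ (n ∸ i) x) *
  J-below {i} x i<n with i ≡ᵇ n | ≡ᵇ⇒≡ i n
  ... | true  | i≡n = ⊥-elim (<-irrefl (i≡n _) i<n)
  ... | false | _   = refl

  J-reflected : ∀ {m} x → 1 ≤ m → m < n → J (n ∸ m) x ≡ φ (suc m) x ∧ (φ m x) *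
  J-reflected {m} x 1≤m m<n = begin
    J (n ∸ m) x                                      ≡⟨ J-below x (∸-< 1≤m (<⇒≤ m<n)) ⟩
    φ (suc (n ∸ (n ∸ m))) x ∧ (φ (n ∸ (n ∸ m)) x) *  ≡⟨ cong (λ k → φ (suc k) x ∧ (φ k x) *) (m∸[m∸n]≡n (<⇒≤ m<n)) ⟩
    φ (suc m) x ∧ (φ m x) *                          ∎

  φ-* : ∀ {i} x → 1 ≤ i → i ≤ n → φ (suc n ∸ i) (x *) ≡ (φ i x) *
  φ-* {i} x 1≤i i≤n =
    trans (uncurry (L4 (suc n ∸ i)) (reflect-bounds 1≤i i≤n) x)
          (cong (λ k → (φ k x) *) (m∸[m∸n]≡n (≤-trans i≤n (n≤1+n n))))

  -- Each φᵢ preserves meets as well as joins (L1, L4 and De Morgan).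
  φ-∧ : ∀ {i} → 1 ≤ i → i ≤ n → ∀ x y → φ i (x ∧ y) ≡ φ i x ∧ φ i y
  φ-∧ {i} 1≤i i≤n x y = begin
    φ i (x ∧ y)                    ≡⟨ cong (φ i) (sym (∧-via-∨ x y)) ⟩
    φ i ((x * ∨ y *) *)            ≡⟨ L4 i 1≤i i≤n _ ⟩
    (φ i′ (x * ∨ y *)) *           ≡⟨ cong _* (uncurry (L1 i′) (reflect-bounds 1≤i i≤n) (x *) (y *)) ⟩
    (φ i′ (x *) ∨ φ i′ (y *)) *    ≡⟨ cong₂ (λ u v → (u ∨ v) *) (φ-* x 1≤i i≤n) (φ-* y 1≤i i≤n) ⟩
    ((φ i x) * ∨ (φ i y) *) *      ≡⟨ ∧-via-∨ (φ i x) (φ i y) ⟩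
    φ i x ∧ φ i y                  ∎
    where
    i′ : ℕ
    i′ = suc n ∸ i

  -- Each φⱼ fixes the complements of values of φᵢ (L4 and L3).
  φ-fixes-φ* : ∀ {i j} → 1 ≤ i → i ≤ n → 1 ≤ j → j ≤ n → ∀ x → φ j ((φ i x) *) ≡ (φ i x) *
  φ-fixes-φ* {i} {j} 1≤i i≤n 1≤j j≤n x =
    trans (L4 j 1≤j j≤n _) (cong _* (uncurry (L3 (suc n ∸ j) i) (reflect-bounds 1≤j j≤n) 1≤i i≤n x))

  -- J2: Jₗ x is built from complemented values of φ by ∧ and *.
  J-complemented : ∀ {l} x → 1 ≤ l → l ≤ n → Complemented (J l x)
  J-complemented {l} x 1≤l l≤n with m≤n⇒m<n∨m≡n l≤n
  ... | inj₂ refl = subst Complemented (sym (J-top x)) (L2 1 (s≤s z≤n) 1≤n x)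
  ... | inj₁ l<n  = subst Complemented (sym (J-below x l<n))
                      (complemented-∧ (L2 _ (s≤s z≤n) (∸-< 1≤l l≤n) x)
                                      (complemented-* (L2 _ (m<n⇒0<n∸m l<n) (m∸n≤m n l) x)))

  J≼φ : ∀ {l} x → l ≤ n → J l x ≼ φ (suc (n ∸ l)) x
  J≼φ {l} x l≤n with m≤n⇒m<n∨m≡n l≤n
  ... | inj₂ refl = subst₂ _≼_ (sym (J-top x)) (cong (λ k → φ (suc k) x) (sym (n∸n≡0 n))) ≼-refl
  ... | inj₁ l<n  = subst (_≼ φ (suc (n ∸ l)) x) (sym (J-below x l<n)) x∧y≼x

  J⟂φ : ∀ {l} x → l < n → J l x ⟂ φ (n ∸ l) x
  J⟂φ {l} x l<n = subst (_≼ (φ (n ∸ l) x) *) (sym (J-below x l<n)) x∧y≼y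

  -- Every φⱼ fixes every Jᵢ x, since Jᵢ x is built from φ's by ∧ and *.
  φ-fixes-J : ∀ {i j} → 1 ≤ j → j ≤ n → 1 ≤ i → i ≤ n → ∀ x → φ j (J i x) ≡ J i x
  φ-fixes-J {i} {j} 1≤j j≤n 1≤i i≤n x with m≤n⇒m<n∨m≡n i≤n
  ... | inj₂ refl = begin
    φ j (J n x)    ≡⟨ cong (φ j) (J-top x) ⟩
    φ j (φ 1 x)    ≡⟨ L3 j 1 1≤j j≤n (s≤s z≤n) 1≤n x ⟩
    φ 1 x          ≡⟨ sym (J-top x) ⟩
    J n x          ∎
  ... | inj₁ i<n  = begin
    φ j (J i x)                                      ≡⟨ cong (φ j) (J-below x i<n) ⟩
    φ j (φ (suc (n ∸ i)) x ∧ (φ (n ∸ i) x) *)        ≡⟨ φ-∧ 1≤j j≤n _ _ ⟩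
    φ j (φ (suc (n ∸ i)) x) ∧ φ j ((φ (n ∸ i) x) *)  ≡⟨ cong₂ _∧_ (L3 j _ 1≤j j≤n (s≤s z≤n) (∸-< 1≤i i≤n) x)
                                                                  (φ-fixes-φ* (m<n⇒0<n∸m i<n) (m∸n≤m n i) 1≤j j≤n x) ⟩
    φ (suc (n ∸ i)) x ∧ (φ (n ∸ i) x) *              ≡⟨ sym (J-below x i<n) ⟩
    J i x                                            ∎

  -- Telescoping: φᵢ x is the join of the top segment J_{n-i+1} x ∨ … ∨ Jₙ x.
  ⋁top-J : ∀ x i → 1 ≤ i → i ≤ n → ⋁top (λ k → J k x) i ≡ φ i x
  ⋁top-J x (suc zero)    _ _   = trans (⋁top-step (λ k → J k x) 1≤n) (trans (∨-identityʳ _) (J-top x))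
  ⋁top-J x (suc (suc i)) _ i<n = begin
    ⋁top (λ k → J k x) (suc (suc i))                 ≡⟨ ⋁top-step (λ k → J k x) i<n ⟩
    J (n ∸ suc i) x ∨ ⋁top (λ k → J k x) (suc i)     ≡⟨ cong₂ _∨_ (J-reflected x (s≤s z≤n) i<n)
                                                                  (⋁top-J x (suc i) (s≤s z≤n) (<⇒≤ i<n)) ⟩
    (φ (suc (suc i)) x ∧ (φ (suc i) x) *) ∨ φ (suc i) x
                                                     ≡⟨ difference-∨ (L2 (suc i) (s≤s z≤n) (<⇒≤ i<n) x)
                                                          (L5 (suc i) (suc (suc i)) (s≤s z≤n) (<⇒≤ i<n) (s≤s z≤n) i<n (n≤1+n _) x) ⟩
    φ (suc (suc i)) x                                ∎

  -- Distinct pieces are orthogonal: for k < l, Jₗ x ≤ φ_{n-l+1} x ≤ φ_{n-k} x ⟂ Jₖ x.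
  J-orthogonal : ∀ {k l} x → 1 ≤ k → k < l → l ≤ n → J k x ⟂ J l x
  J-orthogonal {k} {l} x 1≤k k<l l≤n =
    ⟂-sym (≼-trans (J≼φ x l≤n) (≼-trans φ-mono (⟂-sym (J⟂φ x k<n))))
    where
    k<n : k < n
    k<n = <-≤-trans k<l l≤n
    φ-mono : φ (suc (n ∸ l)) x ≼ φ (n ∸ k) x
    φ-mono = L5 _ _ (s≤s z≤n) (∸-< (≤-trans 1≤k (<⇒≤ k<l)) l≤n) (m<n⇒0<n∸m k<n) (m∸n≤m n k)
                (subst (suc (n ∸ l) ≤_) (suc-∸-suc k<n) (s≤s (∸-monoʳ-≤ n k<l))) x

  -- J1 is L1 transported along the telescoping identity.
  J1′ : ∀ i → 1 ≤ i → i ≤ n → ∀ x y →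
        ⋁top (λ k → J k (x ∨ y)) i ≡ ⋁top (λ k → J k x ∨ J k y) i
  J1′ i 1≤i i≤n x y = begin
    ⋁top (λ k → J k (x ∨ y)) i                   ≡⟨ ⋁top-J (x ∨ y) i 1≤i i≤n ⟩
    φ i (x ∨ y)                                  ≡⟨ L1 i 1≤i i≤n x y ⟩
    φ i x ∨ φ i y                                ≡⟨ sym (cong₂ _∨_ (⋁top-J x i 1≤i i≤n) (⋁top-J y i 1≤i i≤n)) ⟩
    ⋁top (λ k → J k x) i ∨ ⋁top (λ k → J k y) i  ≡⟨ sym (⋁-∨ (λ k → J k x) (λ k → J k y) _ i) ⟩
    ⋁top (λ k → J k x ∨ J k y) i                 ∎

  J3a′ : ∀ i k → 1 ≤ i → i ≤ n → 1 ≤ k → k < n → ∀ x → J k (J i x) ≡ 𝟘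
  J3a′ i k 1≤i i≤n 1≤k k<n x = begin
    J k (J i x)                                              ≡⟨ J-below (J i x) k<n ⟩
    φ (suc (n ∸ k)) (J i x) ∧ (φ (n ∸ k) (J i x)) *          ≡⟨ cong₂ (λ u v → u ∧ v *)
        (φ-fixes-J (s≤s z≤n) (∸-< 1≤k (<⇒≤ k<n)) 1≤i i≤n x)
        (φ-fixes-J (m<n⇒0<n∸m k<n) (m∸n≤m n k) 1≤i i≤n x) ⟩
    J i x ∧ (J i x) *                                        ≡⟨ complemented-∧* (J-complemented x 1≤i i≤n) ⟩
    𝟘                                                        ∎

  J3b′ : ∀ i → 1 ≤ i → i ≤ n → ∀ x → J n (J i x) ≡ J i x
  J3b′ i 1≤i i≤n x = trans (J-top (J i x)) (φ-fixes-J (s≤s z≤n) 1≤n 1≤i i≤n x)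

  J4a′ : ∀ k → 1 ≤ k → k < n → ∀ x → J k (x *) ≡ J (n ∸ k) x
  J4a′ k 1≤k k<n x = begin
    J k (x *)                                              ≡⟨ J-below (x *) k<n ⟩
    φ (suc (n ∸ k)) (x *) ∧ (φ (n ∸ k) (x *)) *            ≡⟨ cong₂ (λ u v → u ∧ v *)
        (L4 (suc (n ∸ k)) (s≤s z≤n) (∸-< 1≤k (<⇒≤ k<n)) x) (L4 (n ∸ k) (m<n⇒0<n∸m k<n) (m∸n≤m n k) x) ⟩
    (φ (n ∸ (n ∸ k)) x) * ∧ ((φ (suc n ∸ (n ∸ k)) x) *) *  ≡⟨ cong₂ (λ u v → (φ u x) * ∧ v)
        (m∸[m∸n]≡n (<⇒≤ k<n)) (*-involutive _) ⟩
    (φ k x) * ∧ φ (suc n ∸ (n ∸ k)) x                      ≡⟨ cong (λ u → (φ k x) * ∧ φ u x) (suc-∸-∸ (<⇒≤ k<n)) ⟩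
    (φ k x) * ∧ φ (suc k) x                                ≡⟨ ∧-comm _ _ ⟩
    φ (suc k) x ∧ (φ k x) *                                ≡⟨ sym (J-reflected x 1≤k k<n) ⟩
    J (n ∸ k) x                                            ∎

  J4b′ : ∀ x → J n (x *) ≡ ⋀ (λ i → (J i x) *) 1 n
  J4b′ x = begin
    J n (x *)                      ≡⟨ J-top (x *) ⟩
    φ 1 (x *)                      ≡⟨ L4 1 (s≤s z≤n) 1≤n x ⟩
    (φ n x) *                      ≡⟨ cong _* (sym (⋁top-J x n 1≤n ≤-refl)) ⟩
    (⋁top (λ k → J k x) n) *       ≡⟨ cong _* (⋁top-full (λ k → J k x)) ⟩
    (⋁ (λ k → J k x) 1 n) *        ≡⟨ sym (⋀-* (λ k → J k x) 1 n) ⟩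
    ⋀ (λ i → (J i x) *) 1 n        ∎

  -- J5 is the orthogonality of Jₗ x to each earlier piece.
  J5′ : ∀ l → 1 < l → l ≤ n → ∀ x → J l x ≼ (⋁ (λ k → J k x) 1 (l ∸ 1)) *
  J5′ (suc l) _ l<n x =
    ⟂-sym (⋁-lub (λ k → J k x) 1 l (λ k 1≤k k≤l → J-orthogonal x 1≤k k≤l l<n))

  -- J6 reduces to L6: the J's determine every φᵢ = ⋁top J i.
  J6′ : ∀ x y → (∀ i → 1 ≤ i → i ≤ n → J i x ≡ J i y) → x ≡ y
  J6′ x y Jx≡Jy = L6 x y λ i 1≤i i≤n → begin
    φ i x                   ≡⟨ sym (⋁top-J x i 1≤i i≤n) ⟩
    ⋁top (λ k → J k x) i    ≡⟨ ⋁top-cong (λ k → J k x) (λ k → J k y) i≤n Jx≡Jy ⟩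
    ⋁top (λ k → J k y) i    ≡⟨ ⋁top-J y i 1≤i i≤n ⟩
    φ i y                   ∎

  jAxioms : JAxioms L n J
  jAxioms = record
    { J1 = J1′ ; J2 = λ i 1≤i i≤n x → J-complemented x 1≤i i≤n
    ; J3a = J3a′ ; J3b = J3b′ ; J4a = J4a′ ; J4b = J4b′ ; J5 = J5′ ; J6 = J6′ }

-- Part (b): from J₁, …, Jₙ satisfying J1–J6 to φ := ΦfromJ satisfying L1–L6.

module FromJ (L : DeMorganAlgebra) (n : ℕ)
             (J : ℕ → DeMorganAlgebra.Carrier L → DeMorganAlgebra.Carrier L)
             (ax : JAxioms L n J) where
  open DeMorganAlgebra L
  open DeMorganProperties L
  open TopSegments L n
  open JAxioms ax
  open ≡-Reasoning

  φ : ℕ → Carrier → Carrier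
  φ = ΦfromJ L n J

  -- Distinct pieces are orthogonal: by J5, Jₖ x ⟂ J₁ x ∨ … ∨ J_{k-1} x.
  J-orthogonal : ∀ {j k} x → 1 ≤ j → j < k → k ≤ n → J j x ⟂ J k x
  J-orthogonal {j} {suc k} x 1≤j j<k k≤n =
    ⟂-sym (≼-trans (J5 (suc k) (s≤s (≤-trans 1≤j (s≤s⁻¹ j<k))) k≤n x)
                   (*-antitone (⋁-ub (λ i → J i x) 1 k 1≤j j<k)))

  -- L1 is J1 together with the distribution of ⋁ over ∨.
  φ-∨ : ∀ i → 1 ≤ i → i ≤ n → ∀ x y → φ i (x ∨ y) ≡ φ i x ∨ φ i y
  φ-∨ i 1≤i i≤n x y = trans (J1 i 1≤i i≤n x y) (⋁-∨ (λ k → J k x) (λ k → J k y) _ i)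

  -- L2: joins of complemented pieces are complemented.
  φ-complemented : ∀ {i} x → i ≤ n → Complemented (φ i x)
  φ-complemented x i≤n = ⋁top-closed Complemented complemented-𝟘 complemented-∨ (λ k → J k x) i≤n
    (λ k n-i<k k≤n → J2 k (≤-trans (s≤s z≤n) n-i<k) k≤n x)

  -- Every φᵢ fixes every Jₘ x: by J3 only the top piece Jₙ(Jₘ x) = Jₘ x survives.
  φ-fixes-J : ∀ {i m} → 1 ≤ i → i ≤ n → 1 ≤ m → m ≤ n → ∀ x → φ i (J m x) ≡ J m x
  φ-fixes-J {i} {m} 1≤i i≤n 1≤m m≤n x =
    trans (⋁top-single (λ k → J k (J m x)) (λ k 1≤k k<n → J3a m k 1≤m m≤n 1≤k k<n x) i 1≤i i≤n)
          (J3b m 1≤m m≤n x)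

  -- L3: φᵢ distributes over the pieces of φⱼ x and fixes each of them.
  φ-idempotent : ∀ i j → 1 ≤ i → i ≤ n → 1 ≤ j → j ≤ n → ∀ x → φ i (φ j x) ≡ φ j x
  φ-idempotent i j 1≤i i≤n 1≤j j≤n x =
    trans (⋁top-hom (φ i) (φ-∨ i 1≤i i≤n) (λ k → J k x) 1≤j)
          (⋁top-cong _ _ j≤n (λ k 1≤k k≤n → φ-fixes-J 1≤i i≤n 1≤k k≤n x))

  J⟂φ : ∀ {k} x → 1 ≤ k → k ≤ n → J k x ⟂ φ (n ∸ k) x
  J⟂φ {k} x 1≤k k≤n = ⟂-sym (⋁top-lub (λ j → J j x) (m∸n≤m n k)
    (λ j n-[n-k]<j j≤n → ⟂-sym (J-orthogonal x 1≤k (subst (_< j) (m∸[m∸n]≡n k≤n) n-[n-k]<j) j≤n)))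

  φ-split : ∀ {k} x → 1 ≤ k → k ≤ n → φ (suc (n ∸ k)) x ≡ J k x ∨ φ (n ∸ k) x
  φ-split {k} x 1≤k k≤n =
    trans (⋁top-step (λ j → J j x) (∸-< 1≤k k≤n)) (cong (λ j → J j x ∨ φ (n ∸ k) x) (m∸[m∸n]≡n k≤n))

  -- Consequently Jₖ is recovered from φ exactly as in JfromΦ.
  J-recover : ∀ {k} x → 1 ≤ k → k ≤ n → J k x ≡ φ (suc (n ∸ k)) x ∧ (φ (n ∸ k) x) *
  J-recover {k} x 1≤k k≤n = sym (begin
    φ (suc (n ∸ k)) x ∧ (φ (n ∸ k) x) *      ≡⟨ cong (_∧ (φ (n ∸ k) x) *) (φ-split x 1≤k k≤n) ⟩
    (J k x ∨ φ (n ∸ k) x) ∧ (φ (n ∸ k) x) *  ≡⟨ ∨-∧*-cancel (φ-complemented x (m∸n≤m n k)) (J⟂φ x 1≤k k≤n) ⟩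
    J k x                                    ∎)

  φ-of-* : ∀ x i → i < n → φ (suc i) (x *) ≡ (φ (n ∸ i) x) *
  φ-of-* x zero 0<n = begin
    φ 1 (x *)                  ≡⟨ ⋁top-step (λ k → J k (x *)) 0<n ⟩
    J n (x *) ∨ 𝟘              ≡⟨ ∨-identityʳ _ ⟩
    J n (x *)                  ≡⟨ J4b x ⟩
    ⋀ (λ i → (J i x) *) 1 n    ≡⟨ ⋀-* (λ k → J k x) 1 n ⟩
    (⋁ (λ k → J k x) 1 n) *    ≡⟨ cong _* (sym (⋁top-full (λ k → J k x))) ⟩
    (φ n x) *                  ∎
  φ-of-* x (suc i) i+1<n = begin
    φ (suc (suc i)) (x *)                            ≡⟨ ⋁top-step (λ k → J k (x *)) i+1<n ⟩
    J (n ∸ suc i) (x *) ∨ φ (suc i) (x *)            ≡⟨ cong₂ _∨_ (J4a (n ∸ suc i) (m<n⇒0<n∸m i+1<n) (∸-< (s≤s z≤n) (<⇒≤ i+1<n)) x)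
                                                                  (φ-of-* x i (<⇒≤ i+1<n)) ⟩
    J (n ∸ (n ∸ suc i)) x ∨ (φ (n ∸ i) x) *          ≡⟨ cong₂ (λ k u → J k x ∨ u *) (m∸[m∸n]≡n (<⇒≤ i+1<n)) split ⟩
    J (suc i) x ∨ (J (suc i) x ∨ φ (n ∸ suc i) x) *  ≡⟨ ∨-*-absorb (J2 (suc i) (s≤s z≤n) (<⇒≤ i+1<n) x)
                                                                   (J⟂φ x (s≤s z≤n) (<⇒≤ i+1<n)) ⟩
    (φ (n ∸ suc i) x) *                              ∎
    where
    split : φ (n ∸ i) x ≡ J (suc i) x ∨ φ (n ∸ suc i) x
    split = trans (cong (λ a → φ a x) (sym (suc-∸-suc (<⇒≤ i+1<n)))) (φ-split x (s≤s z≤n) (<⇒≤ i+1<n))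

  -- L6 reduces to J6 via J-recover.
  φ-injective : ∀ x y → (∀ i → 1 ≤ i → i ≤ n → φ i x ≡ φ i y) → x ≡ y
  φ-injective x y φx≡φy = J6 x y λ k 1≤k k≤n → begin
    J k x                                    ≡⟨ J-recover x 1≤k k≤n ⟩
    φ (suc (n ∸ k)) x ∧ (φ (n ∸ k) x) *      ≡⟨ cong₂ (λ u v → u ∧ v *) (φx≡φy _ (s≤s z≤n) (∸-< 1≤k k≤n))
                                                                       (φ≡ (n ∸ k) (m∸n≤m n k)) ⟩
    φ (suc (n ∸ k)) y ∧ (φ (n ∸ k) y) *      ≡⟨ sym (J-recover y 1≤k k≤n) ⟩
    J k y                                    ∎
    where
    -- φ₀ is the empty join, so the hypothesis extends to index 0.
    φ≡ : ∀ m → m ≤ n → φ m x ≡ φ m y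
    φ≡ zero    _   = refl
    φ≡ (suc m) m<n = φx≡φy (suc m) (s≤s z≤n) m<n

  lAxioms : LAxioms L n φ
  lAxioms = record
    { L1 = φ-∨
    ; L2 = λ i _ i≤n x → φ-complemented x i≤n
    ; L3 = φ-idempotent
    ; L4 = λ { (suc i) _ i<n x → φ-of-* x i i<n }
    ; L5 = λ i j _ _ _ j≤n i≤j x → ⋁top-mono (λ k → J k x) i≤j j≤n
    ; L6 = φ-injective
    }

mainTheorem1 : (n : ℕ) → 1 ≤ n → (L : DeMorganAlgebra) →
    ((φ : ℕ → DeMorganAlgebra.Carrier L → DeMorganAlgebra.Carrier L) →
       LAxioms L n φ → JAxioms L n (JfromΦ L n φ))
    ×
    ((J : ℕ → DeMorganAlgebra.Carrier L → DeMorganAlgebra.Carrier L) →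
       JAxioms L n J → LAxioms L n (ΦfromJ L n J))
mainTheorem1 n 1≤n L =
  (λ φ ax → FromΦ.jAxioms L n 1≤n φ ax) , (λ J ax → FromJ.lAxioms L n J ax)
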